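{- Let $r$ be a positive integer and let $\mathbb{M}=(V,\mathcal{C})$ be the rank-$r$ uniform matroid on $n\ge r+1$ elements, i.e. $\mathcal{C}=\{C\subseteq V:|C|=r+1\}$, $|V|=n$. Let $|\mathbb{M}|_C$ be the minimum cardinality of a subfamily $\mathcal{D}\subseteq\mathcal{C}$ with $\Phi_{\mathcal{D}}=\Phi_{\mathcal{C}}$, and let $c(n,r+1,r)$ be the minimum size of a covering $(n,r+1,r)$-system. Then $c(n,r+1,r)\le|\mathbb{M}|_C\le 2\,c(n,r+1,r)$.
   Context: Boolean functions on $V$ are viewed as functions of subsets; the clause $B\to v$ ($v\notin B$) has true sets the $T$ with $B\not\subseteq T$ or $B\cup\{v\}\subseteq T$; $\Phi_{\mathcal{H}}=\bigwedge_{H\in\mathcal{H}}\bigwedge_{v\in H}((H\setminus\{v\})\to v)$, compared as Boolean functions. A covering $(n,q,r)$-system is a $q$-uniform hypergraph on an $n$-element vertex set such that every $r$-element subset of vertices is contained in at least one hyperedge. -}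

module Defs where

open import Data.Nat using (ℕ; suc; _≤_; _*_)
open import Data.Fin using (Fin)
open import Data.Fin.Subset using (Subset; _∈_; _⊆_; _⊈_; _∪_; _-_; ⁅_⁆; ∣_∣)
open import Data.List using (List; length)
open import Data.List.Relation.Unary.All using (All)
open import Data.List.Relation.Unary.Any using (Any)
open import Data.List.Relation.Unary.Unique.Propositional using (Unique)
import Data.List.Membership.Propositional as L
open import Data.Product using (_×_; Σ; ∃)
open import Data.Sum using (_⊎_)
open import Function.Bundles using (_⇔_)

Family : ℕ → Set₁
Family n = Subset n → Set

record FinFamily (n : ℕ) : Set where
  constructor mkFam
  field
    members : List (Subset n)
    unique  : Unique members
open FinFamily public

card : ∀ {n} → FinFamily n → ℕ
card 𝒟 = length (members 𝒟)

asFamily : ∀ {n} → FinFamily n → Family n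
asFamily 𝒟 H = H L.∈ members 𝒟

-- The clause B → v, as a Boolean function of subsets T (true-set given as a predicate):
-- T is a true set iff B ⊈ T or B ∪ {v} ⊆ T.
Clause : ∀ {n} → Subset n → Fin n → Subset n → Set
Clause B v T = B ⊈ T ⊎ (B ∪ ⁅ v ⁆) ⊆ T

Φ : ∀ {n} → Family n → Subset n → Set
Φ ℋ T = ∀ H → ℋ H → ∀ v → v ∈ H → Clause (H - v) v T

_≐_ : ∀ {n} → (Subset n → Set) → (Subset n → Set) → Set
f ≐ g = ∀ T → f T ⇔ g T

UniformCircuits : (n r : ℕ) → Family n
UniformCircuits n r C = ∣ C ∣ ≡ suc r
  where open import Relation.Binary.PropositionalEquality using (_≡_)

IsCircuitCover : (n r : ℕ) → FinFamily n → Set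
IsCircuitCover n r 𝒟 =
  All (UniformCircuits n r) (members 𝒟) × (Φ (asFamily 𝒟) ≐ Φ (UniformCircuits n r))

IsMinCircuitCover : (n r m : ℕ) → Set
IsMinCircuitCover n r m =
  Σ (FinFamily n) (λ 𝒟 → IsCircuitCover n r 𝒟 × card 𝒟 ≡ m)
  × (∀ 𝒟 → IsCircuitCover n r 𝒟 → m ≤ card 𝒟)
  where open import Relation.Binary.PropositionalEquality using (_≡_)

IsCoveringSystem : (n q r : ℕ) → FinFamily n → Set
IsCoveringSystem n q r ℋ =
  All (λ H → ∣ H ∣ ≡ q) (members ℋ)
  × (∀ (S : Subset n) → ∣ S ∣ ≡ r → Any (λ H → S ⊆ H) (members ℋ))
  where open import Relation.Binary.PropositionalEquality using (_≡_)

IsCoveringNumber : (n q r c : ℕ) → Set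
IsCoveringNumber n q r c =
  Σ (FinFamily n) (λ ℋ → IsCoveringSystem n q r ℋ × card ℋ ≡ c)
  × (∀ ℋ → IsCoveringSystem n q r ℋ → c ≤ card ℋ)
  where open import Relation.Binary.PropositionalEquality using (_≡_)

-- Φ_ℋ holds at T exactly when T is closed under every H ∈ ℋ: if all but one element
-- of H lie in T, so does the remaining one. For the uniform matroid the closed sets are
-- the sets with fewer than r elements and V itself.
--
-- Lower bound: if no member of a circuit cover 𝒟 contains the r-set S, then S is closed
-- under 𝒟 but not under all circuits; so 𝒟 is a covering (n,r+1,r)-system.
--
-- Upper bound: order V = {0,…,n-1} and, for a covering system ℋ, add to each H ∈ ℋ the
-- set obtained by trading the largest element of H for the smallest element outside H.
-- If T is closed under this family of size ≤ 2|ℋ| and contains an r-set, then every k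
-- lies in T, by induction on k. For k < r, take an edge H ⊇ S where S ⊆ T is an r-set
-- containing {0,…,k-1}; then H ⊆ T, and if k ∉ H, k is the first gap of H and the
-- traded set puts k in T. For k ≥ r, take an edge H ⊇ S where S ⊆ {0,…,k} is an r-set
-- containing k, H = S ∪ {w}: if w < k, H itself puts k in T; if w > k, w is the largest
-- element of H and the smallest element outside H lies below k, so the traded set does.

module Submission where

open import Defs
open import Data.Nat using (ℕ; suc; _≤_; _*_)
open import Data.Product using (_×_)

open import Data.Bool as Bool using (true; false; if_then_else_)
open import Data.Empty using (⊥-elim)
open import Data.Fin as Fin using (Fin; toℕ)
import Data.Fin.Induction as Fin
import Data.Fin.Properties as Fin
open import Data.Fin.Subset
open import Data.Fin.Subset.Properties
open import Data.List as List using (List; length; _++_; deduplicate)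
open import Data.List.Properties using (length-++; length-map; length-deduplicate)
import Data.List.Membership.Propositional as L
open import Data.List.Membership.Propositional using (find; lose)
open import Data.List.Membership.Propositional.Properties
  using (∈-++⁺ˡ; ∈-++⁺ʳ; ∈-++⁻; ∈-map⁺; ∈-map⁻; ∈-deduplicate⁺; ∈-deduplicate⁻)
import Data.List.Relation.Unary.All as All
open import Data.List.Relation.Unary.Any as Any using (Any)
open import Data.List.Relation.Unary.Unique.DecPropositional.Properties using (deduplicate-!)
open import Data.Maybe as Maybe using (Maybe; just; nothing)
open import Data.Nat as ℕ using (zero; _+_; _<_; z≤n; s≤s; _≤?_)
import Data.Nat.Properties as ℕ
open import Data.Product using (∃; _,_; proj₁; proj₂)
open import Data.Sum using (_⊎_; inj₁; inj₂)
open import Data.Vec using ([]; _∷_; here; there)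
import Data.Vec.Properties as Vec
open import Function using (_∘_; case_of_)
open import Function.Bundles using (_⇔_; mk⇔; Equivalence)
import Induction.WellFounded as WF
open import Relation.Binary.Definitions using (Tri; tri<; tri≈; tri>; DecidableEquality)
open import Relation.Binary.PropositionalEquality
open import Relation.Nullary using (¬_; Dec; yes; no; contradiction)

private
  variable
    n : ℕ
    p q : Subset n
    x y : Fin n

x∉p-x : ∀ (p : Subset n) x → x ∉ p - x
x∉p-x (_ ∷ p) (Fin.suc x) (there x∈p-x) = x∉p-x p x x∈p-x

x∈p-y⇒x≢y : x ∈ p - y → x ≢ y
x∈p-y⇒x≢y {p = p} {y = y} x∈p-y refl = x∉p-x p y x∈p-y

x∈p⇒suc∣p-x∣≡∣p∣ : x ∈ p → suc ∣ p - x ∣ ≡ ∣ p ∣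
x∈p⇒suc∣p-x∣≡∣p∣ {p = _ ∷ p} here              = cong (λ q → suc ∣ q ∣) (p─⊥≡p p)
x∈p⇒suc∣p-x∣≡∣p∣ {p = true ∷ p}  (there x∈p) = cong suc (x∈p⇒suc∣p-x∣≡∣p∣ x∈p)
x∈p⇒suc∣p-x∣≡∣p∣ {p = false ∷ p} (there x∈p) = x∈p⇒suc∣p-x∣≡∣p∣ x∈p

x∉p⇒∣p∪⁅x⁆∣≡suc∣p∣ : x ∉ p → ∣ p ∪ ⁅ x ⁆ ∣ ≡ suc ∣ p ∣
x∉p⇒∣p∪⁅x⁆∣≡suc∣p∣ {x = Fin.zero}  {true ∷ p}  x∉p = contradiction here x∉p
x∉p⇒∣p∪⁅x⁆∣≡suc∣p∣ {x = Fin.zero}  {false ∷ p} x∉p = cong (λ q → suc ∣ q ∣) (∪-identityʳ p)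
x∉p⇒∣p∪⁅x⁆∣≡suc∣p∣ {x = Fin.suc x} {true ∷ p}  x∉p = cong suc (x∉p⇒∣p∪⁅x⁆∣≡suc∣p∣ (x∉p ∘ there))
x∉p⇒∣p∪⁅x⁆∣≡suc∣p∣ {x = Fin.suc x} {false ∷ p} x∉p = x∉p⇒∣p∪⁅x⁆∣≡suc∣p∣ (x∉p ∘ there)

private
  there-witness : ∀ {s t} → (∃ λ x → x ∈ q × x ∉ p) → ∃ λ x → x ∈ s ∷ q × x ∉ t ∷ p
  there-witness (x , x∈q , x∉p) = Fin.suc x , there x∈q , x∉p ∘ drop-there

∣p∣<∣q∣⇒∃x∈q∖p : ∣ p ∣ < ∣ q ∣ → ∃ λ x → x ∈ q × x ∉ p
∣p∣<∣q∣⇒∃x∈q∖p {p = false ∷ p} {true ∷ q}  _       = Fin.zero , here , λ ()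
∣p∣<∣q∣⇒∃x∈q∖p {p = true ∷ p}  {true ∷ q}  ∣p∣<∣q∣ =
  there-witness (∣p∣<∣q∣⇒∃x∈q∖p (ℕ.≤-pred ∣p∣<∣q∣))
∣p∣<∣q∣⇒∃x∈q∖p {p = s ∷ p}     {false ∷ q} ∣p∣<∣q∣ =
  there-witness (∣p∣<∣q∣⇒∃x∈q∖p (ℕ.≤-<-trans (∣p∣≤∣x∷p∣ s p) ∣p∣<∣q∣))

p⊆q∧∣q∣≤∣p∣⇒q⊆p : p ⊆ q → ∣ q ∣ ≤ ∣ p ∣ → q ⊆ p
p⊆q∧∣q∣≤∣p∣⇒q⊆p {p = []}      {[]}      _   _ = λ ()
p⊆q∧∣q∣≤∣p∣⇒q⊆p {p = true ∷ _}  {false ∷ _} p⊆q _ with () ← p⊆q here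
p⊆q∧∣q∣≤∣p∣⇒q⊆p {p = false ∷ _} {false ∷ _} p⊆q ∣q∣≤∣p∣ =
  out⊆ (p⊆q∧∣q∣≤∣p∣⇒q⊆p (drop-∷-⊆ p⊆q) ∣q∣≤∣p∣)
p⊆q∧∣q∣≤∣p∣⇒q⊆p {p = true ∷ _}  {true ∷ _} p⊆q ∣q∣≤∣p∣ =
  in⊆in (p⊆q∧∣q∣≤∣p∣⇒q⊆p (drop-∷-⊆ p⊆q) (ℕ.≤-pred ∣q∣≤∣p∣))
p⊆q∧∣q∣≤∣p∣⇒q⊆p {p = false ∷ _} {true ∷ _} p⊆q ∣q∣≤∣p∣ =
  contradiction ∣q∣≤∣p∣ (ℕ.<⇒≱ (s≤s (p⊆q⇒∣p∣≤∣q∣ (drop-∷-⊆ p⊆q))))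

∃-⊆-between : ∀ r → p ⊆ q → ∣ p ∣ ≤ r → r ≤ ∣ q ∣ →
              ∃ λ s → p ⊆ s × s ⊆ q × ∣ s ∣ ≡ r
∃-⊆-between {p = []} {[]} _ _ _ r≤0 = [] , (λ ()) , (λ ()) , sym (ℕ.n≤0⇒n≡0 r≤0)
∃-⊆-between {p = true ∷ _} {false ∷ _} _ p⊆q _ _ with () ← p⊆q here
∃-⊆-between {p = false ∷ _} {false ∷ _} r p⊆q ∣p∣≤r r≤∣q∣
  with s , p⊆s , s⊆q , ∣s∣≡r ← ∃-⊆-between r (drop-∷-⊆ p⊆q) ∣p∣≤r r≤∣q∣ =
  false ∷ s , out⊆ p⊆s , out⊆ s⊆q , ∣s∣≡r
∃-⊆-between {p = true ∷ _} {true ∷ _} zero _ () _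
∃-⊆-between {p = true ∷ _} {true ∷ _} (suc r) p⊆q ∣p∣≤r r≤∣q∣
  with s , p⊆s , s⊆q , ∣s∣≡r ← ∃-⊆-between r (drop-∷-⊆ p⊆q) (ℕ.≤-pred ∣p∣≤r) (ℕ.≤-pred r≤∣q∣) =
  true ∷ s , in⊆in p⊆s , in⊆in s⊆q , cong suc ∣s∣≡r
∃-⊆-between {p = false ∷ p} {true ∷ q} r p⊆q ∣p∣≤r r≤∣q∣ with r ≤? ∣ q ∣
... | yes r≤∣q∣′
  with s , p⊆s , s⊆q , ∣s∣≡r ← ∃-⊆-between r (drop-∷-⊆ p⊆q) ∣p∣≤r r≤∣q∣′ =
  false ∷ s , out⊆ p⊆s , out⊆ s⊆q , ∣s∣≡r
∃-⊆-between {p = false ∷ p} {true ∷ q} zero _ _ _ | no 0≰∣q∣ = contradiction z≤n 0≰∣q∣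
∃-⊆-between {p = false ∷ p} {true ∷ q} (suc r) p⊆q ∣p∣≤r r≤∣q∣ | no r≰∣q∣
  with s , p⊆s , s⊆q , ∣s∣≡r ←
    ∃-⊆-between r (drop-∷-⊆ p⊆q)
                  (ℕ.≤-trans (p⊆q⇒∣p∣≤∣q∣ (drop-∷-⊆ p⊆q)) (ℕ.≤-pred (ℕ.≰⇒> r≰∣q∣)))
                  (ℕ.≤-pred r≤∣q∣) =
  true ∷ s , out⊆ p⊆s , in⊆in s⊆q , cong suc ∣s∣≡r

p∪⁅x⁆⊆q : p ⊆ q → x ∈ q → p ∪ ⁅ x ⁆ ⊆ q
p∪⁅x⁆⊆q {p = p} {x = x} p⊆q x∈q y∈p∪⁅x⁆ with x∈p∪q⁻ p ⁅ x ⁆ y∈p∪⁅x⁆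
... | inj₁ y∈p  = p⊆q y∈p
... | inj₂ y∈⁅x⁆ rewrite x∈⁅y⁆⇒x≡y x y∈⁅x⁆ = x∈q

x∈p⇒⁅x⁆⊆p : x ∈ p → ⁅ x ⁆ ⊆ p
x∈p⇒⁅x⁆⊆p {x = x} x∈p y∈⁅x⁆ rewrite x∈⁅y⁆⇒x≡y x y∈⁅x⁆ = x∈p

p∪⁅x⁆-x⊆p : p ∪ ⁅ x ⁆ - x ⊆ p
p∪⁅x⁆-x⊆p {p = p} {x = x} y∈p∪⁅x⁆-x with x∈p∪q⁻ p ⁅ x ⁆ (p─q⊆p _ _ y∈p∪⁅x⁆-x)
... | inj₁ y∈p  = y∈p
... | inj₂ y∈⁅x⁆ = contradiction (x∈⁅y⁆⇒x≡y x y∈⁅x⁆) (x∈p-y⇒x≢y y∈p∪⁅x⁆-x)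

p-x⊆q⇒p⊆q : p - x ⊆ q → x ∈ q → p ⊆ q
p-x⊆q⇒p⊆q {x = x} p-x⊆q x∈q {y} y∈p with y Fin.≟ x
... | yes refl = x∈q
... | no y≢x   = p-x⊆q (x∈p∧x≢y⇒x∈p-y y∈p y≢x)

p-x⊆q⁺ : (∀ {y} → y ∈ p → y ≢ x → y ∈ q) → p - x ⊆ q
p-x⊆q⁺ {p = p} {x = x} q⊇p∖x y∈p-x = q⊇p∖x (p─q⊆p p ⁅ x ⁆ y∈p-x) (x∈p-y⇒x≢y y∈p-x)

p⊆q∧∣q∣≡1+∣p∣⇒∃x[q-x≡p] : p ⊆ q → ∣ q ∣ ≡ suc ∣ p ∣ → ∃ λ x → x ∈ q × q - x ≡ p
p⊆q∧∣q∣≡1+∣p∣⇒∃x[q-x≡p] {p = p} {q} p⊆q ∣q∣≡1+∣p∣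
  with x , x∈q , x∉p ← ∣p∣<∣q∣⇒∃x∈q∖p {p = p} {q} (ℕ.≤-reflexive (sym ∣q∣≡1+∣p∣)) =
  x , x∈q , sym (⊆-antisym p⊆q-x (p⊆q∧∣q∣≤∣p∣⇒q⊆p p⊆q-x ∣q-x∣≤∣p∣))
  where
  p⊆q-x : p ⊆ q - x
  p⊆q-x y∈p = x∈p∧x≢y⇒x∈p-y (p⊆q y∈p) λ where refl → x∉p y∈p
  ∣q-x∣≤∣p∣ : ∣ q - x ∣ ≤ ∣ p ∣
  ∣q-x∣≤∣p∣ = ℕ.≤-reflexive (ℕ.suc-injective (trans (x∈p⇒suc∣p-x∣≡∣p∣ x∈q) ∣q∣≡1+∣p∣))

below : ℕ → Subset n
below {zero}  _       = []
below {suc n} zero    = ⊥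
below {suc n} (suc m) = true ∷ below m

∈-below⁺ : ∀ m → toℕ x < m → x ∈ below m
∈-below⁺ {x = Fin.zero}  (suc m) _   = here
∈-below⁺ {x = Fin.suc x} (suc m) x<m = there (∈-below⁺ m (ℕ.≤-pred x<m))

∈-below⁻ : ∀ m → x ∈ below m → toℕ x < m
∈-below⁻ {suc n} zero x∈⊥ = contradiction x∈⊥ ∉⊥
∈-below⁻ {x = Fin.zero}  (suc m) here          = s≤s z≤n
∈-below⁻ {x = Fin.suc x} (suc m) (there x∈below) = s≤s (∈-below⁻ m x∈below)

∣below∣ : ∀ m → m ≤ n → ∣ below {n} m ∣ ≡ m
∣below∣ {zero}  zero    _   = refl
∣below∣ {suc n} zero    _   = ∣⊥∣≡0 (suc n)
∣below∣ {suc n} (suc m) m≤n = cong suc (∣below∣ m (ℕ.≤-pred m≤n))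

∈-below-suc : x ∈ below (suc (toℕ y)) → x ≢ y → x ∈ below (toℕ y)
∈-below-suc {x = x} x∈below x≢y =
  ∈-below⁺ _ (Fin.≤∧≢⇒< (ℕ.≤-pred (∈-below⁻ _ x∈below)) x≢y)

firstOutside : Subset n → Maybe (Fin n)
firstOutside []          = nothing
firstOutside (false ∷ p) = just Fin.zero
firstOutside (true ∷ p)  = Maybe.map Fin.suc (firstOutside p)

firstOutside-nothing : firstOutside p ≡ nothing → ∀ x → x ∈ p
firstOutside-nothing {p = true ∷ p} _ Fin.zero = here
firstOutside-nothing {p = true ∷ p} eq (Fin.suc x) with firstOutside p in eq′
... | nothing = there (firstOutside-nothing eq′ x)

firstOutside-just : firstOutside p ≡ just y → y ∉ p × (∀ x → x ∉ p → y Fin.≤ x)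
firstOutside-just {p = false ∷ p} refl = (λ ()) , λ _ _ → z≤n
firstOutside-just {p = true ∷ p} eq with firstOutside p in eq′
firstOutside-just {p = true ∷ p} refl | just y with y∉p , y-least ← firstOutside-just eq′ =
  y∉p ∘ drop-there , λ where
    Fin.zero    x∉p → contradiction here x∉p
    (Fin.suc x) x∉p → s≤s (y-least x (x∉p ∘ there))

lastInside : Subset n → Maybe (Fin n)
lastInside []      = nothing
lastInside (s ∷ p) with lastInside p
... | just x  = just (Fin.suc x)
... | nothing = if s then just Fin.zero else nothing

lastInside-nothing : lastInside p ≡ nothing → ∀ x → x ∉ p
lastInside-nothing {p = s ∷ p} eq x x∈p with lastInside p in eq′
lastInside-nothing {p = true ∷ p}  () x x∈p | nothing
lastInside-nothing {p = false ∷ p} eq (Fin.suc x) (there x∈p) | nothing =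
  lastInside-nothing eq′ x x∈p

lastInside-just : lastInside p ≡ just x → x ∈ p × (∀ y → y ∈ p → y Fin.≤ x)
lastInside-just {p = s ∷ p} eq with lastInside p in eq′
lastInside-just {p = s ∷ p} refl | just x with x∈p , x-greatest ← lastInside-just eq′ =
  there x∈p , λ where
    Fin.zero    _           → z≤n
    (Fin.suc y) (there y∈p) → s≤s (x-greatest y y∈p)
lastInside-just {p = true ∷ p} refl | nothing = here , λ where
    Fin.zero    _           → z≤n
    (Fin.suc y) (there y∈p) → contradiction y∈p (lastInside-nothing eq′ y)

lastInside-unique : ∀ {w} → lastInside p ≡ just x → w ∈ p → (∀ {z} → z ∈ p - w → z Fin.< w) → x ≡ w
lastInside-unique {p = p} {x} {w} eqx w∈p others<w with x Fin.≟ w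
... | yes x≡w = x≡w
... | no x≢w  = contradiction (proj₂ (lastInside-just eqx) w w∈p)
                  (ℕ.<⇒≱ (others<w (x∈p∧x≢y⇒x∈p-y (proj₁ (lastInside-just eqx)) x≢w)))

shift : Subset n → Subset n
shift p with lastInside p | firstOutside p
... | just x | just y = (p - x) ∪ ⁅ y ⁆
... | _      | _      = p

∣shift∣ : ∀ (p : Subset n) → ∣ shift p ∣ ≡ ∣ p ∣
∣shift∣ p with lastInside p in eqx | firstOutside p in eqy
... | just x  | just y  = begin
  ∣ (p - x) ∪ ⁅ y ⁆ ∣ ≡⟨ x∉p⇒∣p∪⁅x⁆∣≡suc∣p∣ {p = p - x}
                           (proj₁ (firstOutside-just eqy) ∘ p─q⊆p p ⁅ x ⁆) ⟩
  suc ∣ p - x ∣       ≡⟨ x∈p⇒suc∣p-x∣≡∣p∣ {p = p} (proj₁ (lastInside-just eqx)) ⟩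
  ∣ p ∣               ∎
  where open ≡-Reasoning
... | just _  | nothing = refl
... | nothing | _       = refl

shift-drops-top : ∀ {H : Subset n} {w k i} → w ∈ H → H - w ⊆ below (suc (toℕ k)) → k Fin.< w →
                  k ∈ H → i ∉ H → i Fin.≤ k → k ∈ shift H × shift H - k ⊆ below (toℕ k)
shift-drops-top {H = H} {w} {k} {i} w∈H H-w⊆below k<w k∈H i∉H i≤k
  with lastInside H in eqx | firstOutside H in eqy
... | nothing | _       = contradiction w∈H (lastInside-nothing eqx w)
... | just _  | nothing = contradiction (firstOutside-nothing eqy i) i∉H
... | just x  | just y  = drops x≡w
  where
  x≡w : x ≡ w
  x≡w = lastInside-unique eqx w∈H λ z∈H-w → ℕ.≤-<-trans (ℕ.≤-pred (∈-below⁻ _ (H-w⊆below z∈H-w))) k<w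
  y<k : y Fin.< k
  y<k = Fin.≤∧≢⇒< (ℕ.≤-trans (proj₂ (firstOutside-just eqy) i i∉H) i≤k)
                  λ where refl → proj₁ (firstOutside-just eqy) k∈H
  drops : x ≡ w → k ∈ (H - x) ∪ ⁅ y ⁆ × (H - x) ∪ ⁅ y ⁆ - k ⊆ below (toℕ k)
  drops refl = x∈p∪q⁺ (inj₁ (x∈p∧x≢y⇒x∈p-y k∈H (Fin.<⇒≢ k<w))) , p-x⊆q⁺ below-k
    where
    below-k : ∀ {z} → z ∈ (H - x) ∪ ⁅ y ⁆ → z ≢ k → z ∈ below (toℕ k)
    below-k z∈H-x∪⁅y⁆ z≢k with x∈p∪q⁻ (H - x) ⁅ y ⁆ z∈H-x∪⁅y⁆
    ... | inj₁ z∈H-x  = ∈-below-suc (H-w⊆below z∈H-x) z≢k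
    ... | inj₂ z∈⁅y⁆ rewrite x∈⁅y⁆⇒x≡y y z∈⁅y⁆ = ∈-below⁺ _ y<k

shift-fills-gap : ∀ {H : Subset n} {w k} → w ∈ H → below (toℕ k) ⊆ H → k ∉ H →
                  k ∈ shift H × shift H - k ⊆ H
shift-fills-gap {H = H} {w} {k} w∈H below⊆H k∉H
  with lastInside H in eqx | firstOutside H in eqy
... | nothing | _       = contradiction w∈H (lastInside-nothing eqx w)
... | just _  | nothing = contradiction (firstOutside-nothing eqy k) k∉H
... | just x  | just y  = fills y≡k
  where
  y≡k : y ≡ k
  y≡k = Fin.≤-antisym (proj₂ (firstOutside-just eqy) k k∉H)
                      (ℕ.≮⇒≥ λ y<k → proj₁ (firstOutside-just eqy) (below⊆H (∈-below⁺ _ y<k)))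
  fills : y ≡ k → k ∈ (H - x) ∪ ⁅ y ⁆ × (H - x) ∪ ⁅ y ⁆ - k ⊆ H
  fills refl = x∈p∪q⁺ (inj₂ (x∈⁅x⁆ y)) , p─q⊆p H ⁅ x ⁆ ∘ p∪⁅x⁆-x⊆p

ClosedUnder : Subset n → Subset n → Set
ClosedUnder C T = ∀ {v} → v ∈ C → C - v ⊆ T → v ∈ T

Φ⇔closedUnder : ∀ (ℋ : Family n) T → Φ ℋ T ⇔ (∀ C → ℋ C → ClosedUnder C T)
Φ⇔closedUnder ℋ T = mk⇔ to from
  where
  to : Φ ℋ T → ∀ C → ℋ C → ClosedUnder C T
  to Φℋ C C∈ℋ {v} v∈C C-v⊆T with Φℋ C C∈ℋ v v∈C
  ... | inj₁ C-v⊈T    = ⊥-elim (C-v⊈T C-v⊆T)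
  ... | inj₂ C-v∪v⊆T = C-v∪v⊆T (x∈p∪q⁺ (inj₂ (x∈⁅x⁆ v)))
  from : (∀ C → ℋ C → ClosedUnder C T) → Φ ℋ T
  from closed C C∈ℋ v v∈C with C - v ⊆? T
  ... | no C-v⊈T  = inj₁ C-v⊈T
  ... | yes C-v⊆T = inj₂ (p∪⁅x⁆⊆q C-v⊆T (closed C C∈ℋ v∈C C-v⊆T))

Φ-antitone : ∀ {ℋ 𝒢 : Family n} → (∀ C → ℋ C → 𝒢 C) → ∀ T → Φ 𝒢 T → Φ ℋ T
Φ-antitone ℋ⊆𝒢 T Φ𝒢 C C∈ℋ = Φ𝒢 C (ℋ⊆𝒢 C C∈ℋ)

closedUnder-⊈ : ∀ {C S : Subset n} → ∣ C ∣ ≡ suc ∣ S ∣ → S ⊈ C → ClosedUnder C S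
closedUnder-⊈ {C = C} {S} ∣C∣≡1+∣S∣ S⊈C v∈C C-v⊆S =
  ⊥-elim (S⊈C (p─q⊆p C _ ∘ p⊆q∧∣q∣≤∣p∣⇒q⊆p C-v⊆S ∣S∣≤∣C-v∣))
  where
  ∣S∣≤∣C-v∣ : ∣ S ∣ ≤ ∣ C - _ ∣
  ∣S∣≤∣C-v∣ = ℕ.≤-reflexive (ℕ.suc-injective (trans (sym ∣C∣≡1+∣S∣) (sym (x∈p⇒suc∣p-x∣≡∣p∣ v∈C))))

¬closedUnder-∪⁅⁆ : ∀ {S : Subset n} {x} → x ∉ S → ¬ ClosedUnder (S ∪ ⁅ x ⁆) S
¬closedUnder-∪⁅⁆ {x = x} x∉S closed = x∉S (closed (x∈p∪q⁺ (inj₂ (x∈⁅x⁆ x))) p∪⁅x⁆-x⊆p)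

uniform-closedUnder : ∀ {r} {C T : Subset n} → UniformCircuits n r C →
                      (∀ {S} → ∣ S ∣ ≡ r → S ⊆ T → ∀ x → x ∈ T) → ClosedUnder C T
uniform-closedUnder ∣C∣≡1+r full {v} v∈C C-v⊆T =
  full (ℕ.suc-injective (trans (x∈p⇒suc∣p-x∣≡∣p∣ v∈C) ∣C∣≡1+r)) C-v⊆T v

module Saturation {r} (ℋ : FinFamily n) (covering : IsCoveringSystem n (suc r) r ℋ)
                  {T : Subset n}
                  (closed       : ∀ {H} → H L.∈ members ℋ → ClosedUnder H T)
                  (closed-shift : ∀ {H} → H L.∈ members ℋ → ClosedUnder (shift H) T) where

  edge-over : ∀ {S} → ∣ S ∣ ≡ r → ∃ λ H → H L.∈ members ℋ × ∃ λ w → w ∈ H × H - w ≡ S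
  edge-over {S} ∣S∣≡r with H , H∈ℋ , S⊆H ← find (proj₂ covering S ∣S∣≡r) =
    H , H∈ℋ , p⊆q∧∣q∣≡1+∣p∣⇒∃x[q-x≡p] S⊆H
                (trans (All.lookup (proj₁ covering) H∈ℋ) (cong suc (sym ∣S∣≡r)))

  gap-filled : ∀ {H w k} → H L.∈ members ℋ → w ∈ H → H - w ⊆ T → below (toℕ k) ⊆ H → k ∈ T
  gap-filled {H} {w} {k} H∈ℋ w∈H H-w⊆T below⊆H = fill (k ∈? H)
    where
    H⊆T : H ⊆ T
    H⊆T = p-x⊆q⇒p⊆q H-w⊆T (closed H∈ℋ w∈H H-w⊆T)
    fill : Dec (k ∈ H) → k ∈ T
    fill (yes k∈H) = H⊆T k∈H
    fill (no k∉H) with k∈shift , shift-k⊆H ← shift-fills-gap w∈H below⊆H k∉H =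
      closed-shift H∈ℋ k∈shift (⊆-trans shift-k⊆H H⊆T)

  small-index∈T : ∀ {S} k → ∣ S ∣ ≡ r → S ⊆ T → toℕ k < r → below (toℕ k) ⊆ T → k ∈ T
  small-index∈T {S₀} k ∣S₀∣≡r S₀⊆T k<r below⊆T
    with S , below⊆S , S⊆T , ∣S∣≡r ←
           ∃-⊆-between r below⊆T
                       (ℕ.≤-trans (ℕ.≤-reflexive (∣below∣ _ (ℕ.<⇒≤ (Fin.toℕ<n k)))) (ℕ.<⇒≤ k<r))
                       (subst (_≤ ∣ T ∣) ∣S₀∣≡r (p⊆q⇒∣p∣≤∣q∣ S₀⊆T))
    with H , H∈ℋ , w , w∈H , refl ← edge-over {S} ∣S∣≡r =
    gap-filled H∈ℋ w∈H S⊆T (p─q⊆p H _ ∘ below⊆S)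

  top-edge-closes : ∀ {H w k} → H L.∈ members ℋ → w ∈ H → k ∈ H - w →
                    H - w ⊆ below (suc (toℕ k)) → ∣ H - w ∣ ≤ toℕ k → below (toℕ k) ⊆ T → k ∈ T
  top-edge-closes {H} {w} {k} H∈ℋ w∈H k∈H-w H-w⊆below ∣H-w∣≤k below⊆T = by-cases (Fin.<-cmp w k)
    where
    k∈H : k ∈ H
    k∈H = p─q⊆p H _ k∈H-w
    by-cases : Tri (w Fin.< k) (w ≡ k) (k Fin.< w) → k ∈ T
    by-cases (tri< w<k _ _) = closed H∈ℋ k∈H (⊆-trans H-k⊆below below⊆T)
      where
      H-k⊆below : H - k ⊆ below (toℕ k)
      H-k⊆below = p-x⊆q⁺ λ {z} z∈H z≢k → case z Fin.≟ w of λ where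
        (yes refl) → ∈-below⁺ _ w<k
        (no z≢w)   → ∈-below-suc (H-w⊆below (x∈p∧x≢y⇒x∈p-y z∈H z≢w)) z≢k
    by-cases (tri≈ _ refl _) = contradiction k∈H-w (x∉p-x H k)
    by-cases (tri> _ _ k<w) = closed-shift H∈ℋ (proj₁ dropped) (⊆-trans (proj₂ dropped) below⊆T)
      where
      gap = ∣p∣<∣q∣⇒∃x∈q∖p {p = H - w} {q = below (suc (toℕ k))}
              (subst (∣ H - w ∣ <_) (sym (∣below∣ _ (Fin.toℕ<n k))) (s≤s ∣H-w∣≤k))
      i≤k : proj₁ gap Fin.≤ k
      i≤k = ℕ.≤-pred (∈-below⁻ _ (proj₁ (proj₂ gap)))
      i∉H : proj₁ gap ∉ H
      i∉H i∈H = proj₂ (proj₂ gap)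
                  (x∈p∧x≢y⇒x∈p-y i∈H λ i≡w → ℕ.<⇒≱ k<w (subst (Fin._≤ k) i≡w i≤k))
      dropped = shift-drops-top w∈H H-w⊆below k<w k∈H i∉H i≤k

  large-index∈T : ∀ k → 1 ≤ r → r ≤ toℕ k → below (toℕ k) ⊆ T → k ∈ T
  large-index∈T k 1≤r r≤k below⊆T
    with S , k⊆S , S⊆below , ∣S∣≡r ←
           ∃-⊆-between r (x∈p⇒⁅x⁆⊆p (∈-below⁺ (suc (toℕ k)) ℕ.≤-refl))
                       (subst (_≤ r) (sym (∣⁅x⁆∣≡1 k)) 1≤r)
                       (subst (r ≤_) (sym (∣below∣ _ (Fin.toℕ<n k))) (ℕ.m≤n⇒m≤1+n r≤k))
    with H , H∈ℋ , w , w∈H , refl ← edge-over {S} ∣S∣≡r =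
    top-edge-closes H∈ℋ w∈H (k⊆S (x∈⁅x⁆ k)) S⊆below (subst (_≤ toℕ k) (sym ∣S∣≡r) r≤k) below⊆T

  saturated : 1 ≤ r → ∀ {S} → ∣ S ∣ ≡ r → S ⊆ T → ∀ x → x ∈ T
  saturated 1≤r ∣S∣≡r S⊆T = WF.All.wfRec Fin.<-wellFounded _ (_∈ T) step
    where
    step : ∀ k → (∀ {j} → j Fin.< k → j ∈ T) → k ∈ T
    step k below-k⊆T with r ≤? toℕ k
    ... | yes r≤k = large-index∈T k 1≤r r≤k (below-k⊆T ∘ ∈-below⁻ _)
    ... | no r≰k  = small-index∈T k ∣S∣≡r S⊆T (ℕ.≰⇒> r≰k) (below-k⊆T ∘ ∈-below⁻ _)

circuitCover⇒covering : ∀ {r} (𝒟 : FinFamily n) → r < n → IsCircuitCover n r 𝒟 →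
                        IsCoveringSystem n (suc r) r 𝒟
circuitCover⇒covering {n} {r} 𝒟 r<n (sizes , Φ𝒟≐Φ𝒞) = sizes , covers
  where
  covers : ∀ S → ∣ S ∣ ≡ r → Any (S ⊆_) (members 𝒟)
  covers S ∣S∣≡r with Any.any? (S ⊆?_) (members 𝒟)
  ... | yes S⊆C = S⊆C
  ... | no S⊈𝒟
    with x , _ , x∉S ← ∣p∣<∣q∣⇒∃x∈q∖p {p = S} {q = ⊤} (subst₂ _<_ (sym ∣S∣≡r) (sym (∣⊤∣≡n n)) r<n) =
    ⊥-elim (¬closedUnder-∪⁅⁆ x∉S (Equivalence.to (Φ⇔closedUnder _ S) Φ𝒞S (S ∪ ⁅ x ⁆) ∣S∪x∣≡1+r))
    where
    ∣S∪x∣≡1+r : ∣ S ∪ ⁅ x ⁆ ∣ ≡ suc r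
    ∣S∪x∣≡1+r = trans (x∉p⇒∣p∪⁅x⁆∣≡suc∣p∣ x∉S) (cong suc ∣S∣≡r)
    closed-𝒟 : ∀ C → C L.∈ members 𝒟 → ClosedUnder C S
    closed-𝒟 C C∈𝒟 = closedUnder-⊈ (trans (All.lookup sizes C∈𝒟) (cong suc (sym ∣S∣≡r)))
                                    (S⊈𝒟 ∘ lose C∈𝒟)
    Φ𝒞S : Φ (UniformCircuits n r) S
    Φ𝒞S = Equivalence.to (Φ𝒟≐Φ𝒞 S) (Equivalence.from (Φ⇔closedUnder _ S) closed-𝒟)

_≟ₛ_ : DecidableEquality (Subset n)
_≟ₛ_ = Vec.≡-dec Bool._≟_

withShifts : List (Subset n) → List (Subset n)
withShifts hs = hs ++ List.map shift hs

shiftClosure : FinFamily n → FinFamily n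
shiftClosure ℋ = mkFam (deduplicate _≟ₛ_ (withShifts (members ℋ)))
                       (deduplicate-! _≟ₛ_ (withShifts (members ℋ)))

module _ (ℋ : FinFamily n) where

  ∈-shiftClosure⁺ : ∀ {H} → H L.∈ members ℋ → H L.∈ members (shiftClosure ℋ)
  ∈-shiftClosure⁺ H∈ℋ = ∈-deduplicate⁺ _≟ₛ_ (∈-++⁺ˡ H∈ℋ)

  shift-∈-shiftClosure : ∀ {H} → H L.∈ members ℋ → shift H L.∈ members (shiftClosure ℋ)
  shift-∈-shiftClosure H∈ℋ = ∈-deduplicate⁺ _≟ₛ_ (∈-++⁺ʳ (members ℋ) (∈-map⁺ shift H∈ℋ))

  ∈-shiftClosure⁻ : ∀ {C} → C L.∈ members (shiftClosure ℋ) →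
                    C L.∈ members ℋ ⊎ ∃ λ H → H L.∈ members ℋ × C ≡ shift H
  ∈-shiftClosure⁻ C∈ with ∈-++⁻ (members ℋ) (∈-deduplicate⁻ _≟ₛ_ (withShifts (members ℋ)) C∈)
  ... | inj₁ C∈ℋ     = inj₁ C∈ℋ
  ... | inj₂ C∈shifts = inj₂ (∈-map⁻ shift C∈shifts)

  card-shiftClosure : card (shiftClosure ℋ) ≤ 2 * card ℋ
  card-shiftClosure = begin
    length (deduplicate _≟ₛ_ (withShifts hs)) ≤⟨ length-deduplicate _≟ₛ_ (withShifts hs) ⟩
    length (withShifts hs)                    ≡⟨ length-++ hs ⟩
    length hs + length (List.map shift hs)    ≡⟨ cong (length hs +_) (length-map shift hs) ⟩
    length hs + length hs                     ≡⟨ cong (length hs +_) (ℕ.+-identityʳ (length hs)) ⟨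
    2 * length hs                             ∎
    where
    open ℕ.≤-Reasoning
    hs = members ℋ

covering⇒circuitCover : ∀ {r} (ℋ : FinFamily n) → 1 ≤ r → IsCoveringSystem n (suc r) r ℋ →
                        IsCircuitCover n r (shiftClosure ℋ)
covering⇒circuitCover {n} {r} ℋ 1≤r covering@(sizes , _) =
  All.tabulate circuit , λ T → mk⇔ (Φ𝒟⇒Φ𝒞 T) (Φ-antitone (λ _ → circuit) T)
  where
  circuit : ∀ {C} → C L.∈ members (shiftClosure ℋ) → ∣ C ∣ ≡ suc r
  circuit C∈ with ∈-shiftClosure⁻ ℋ C∈
  ... | inj₁ C∈ℋ            = All.lookup sizes C∈ℋ
  ... | inj₂ (H , H∈ℋ , refl) = trans (∣shift∣ H) (All.lookup sizes H∈ℋ)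

  Φ𝒟⇒Φ𝒞 : ∀ T → Φ (asFamily (shiftClosure ℋ)) T → Φ (UniformCircuits n r) T
  Φ𝒟⇒Φ𝒞 T Φ𝒟T = Equivalence.from (Φ⇔closedUnder _ T) λ C C∈𝒞 →
    uniform-closedUnder C∈𝒞 (saturated 1≤r)
    where
    closed : ∀ {C} → C L.∈ members (shiftClosure ℋ) → ClosedUnder C T
    closed = Equivalence.to (Φ⇔closedUnder _ T) Φ𝒟T _
    open Saturation ℋ covering (closed ∘ ∈-shiftClosure⁺ ℋ) (closed ∘ shift-∈-shiftClosure ℋ)

theorem21 : (r n : ℕ) → 1 ≤ r → suc r ≤ n →
    (m c : ℕ) → IsMinCircuitCover n r m → IsCoveringNumber n (suc r) r c →
    c ≤ m × m ≤ 2 * c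
theorem21 r n 1≤r r<n m c ((𝒟 , 𝒟-cover , ∣𝒟∣≡m) , m-minimal)
                          ((ℋ , ℋ-covering , ∣ℋ∣≡c) , c-minimal) =
  subst (c ≤_) ∣𝒟∣≡m (c-minimal 𝒟 (circuitCover⇒covering 𝒟 r<n 𝒟-cover)) ,
  (begin
    m                          ≤⟨ m-minimal (shiftClosure ℋ) (covering⇒circuitCover ℋ 1≤r ℋ-covering) ⟩
    card (shiftClosure ℋ)      ≤⟨ card-shiftClosure ℋ ⟩
    2 * card ℋ                 ≡⟨ cong (2 *_) ∣ℋ∣≡c ⟩
    2 * c                      ∎)
  where open ℕ.≤-Reasoning
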